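{- The union, over all $n\ge 0$ and all choices of nonnegative integers $a_0,\dots,a_n$, of the closed line segments joining $\hat X_{n-1}$ and $X_n\hat{+}X_{n-2}$ is dense in $\Delta$.
   Context: Let $\Delta=\{(x,y)\in\mathbb{R}^2: 1\ge x\ge y>0\}$. For nonnegative integers $a_0,a_1,\dots$ define $C_{ -3}=(1,0,0)$, $C_{ -2}=(0,1,0)$, $C_{ -1}=(0,0,1)$, $C_k=C_{k-3}-C_{k-2}-a_kC_{k-1}$ ($k\ge0$) in $\mathbb{R}^3$, and $X_k=C_k\times C_{k+1}$; one has $X_{ -3}=(0,0,1)$, $X_{ -2}=(1,0,0)$, $X_{ -1}=(1,1,0)$ and $X_k=X_{k-3}+a_kX_{k-2}+X_{k-1}$ for $k\ge0$, so $X_k$ depends only on $a_0,\dots,a_k$. For $V=(a,b,c)$ with $a\ne0$, $\hat V=(b/a,c/a)\in\mathbb{R}^2$; for $V=(a,b,c)$, $W=(d,e,f)$ with $a+d\neq0$, $V\hat{+}W=\left(\frac{b+e}{a+d},\frac{c+f}{a+d}\right)$. (The segment from $\hat X_{n-1}$ to $X_n\hat{+}X_{n-2}$ is an edge of the partition triangle of points of $\Delta$ whose triangle sequence begins $a_0,\dots,a_n$.)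
   Formalization: Density in Δ is asserted only at points of Δ with rational coordinates, to within rational sup-norm distances, and the approximating points on the segments are taken at rational parameters. -}

module Defs where

open import Data.Nat using (ℕ; zero; suc) renaming (_+_ to _+ℕ_; _*_ to _*ℕ_)
open import Data.Integer using (+_)
open import Data.Rational using (ℚ; _/_; _+_; _-_; _*_; 0ℚ)
open import Data.Product using (_×_; _,_)

ℕ³ : Set
ℕ³ = ℕ × ℕ × ℕ

_⊕_ : ℕ³ → ℕ³ → ℕ³
(a , b , c) ⊕ (d , e , f) = (a +ℕ d , b +ℕ e , c +ℕ f)

_⊙_ : ℕ → ℕ³ → ℕ³
k ⊙ (a , b , c) = (k *ℕ a , k *ℕ b , k *ℕ c)

-- XS a j = X_{j-3}:  XS a 0 = X_{-3}, XS a 1 = X_{-2}, XS a 2 = X_{-1},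
-- XS a (k+3) = X_k = X_{k-3} + a_k X_{k-2} + X_{k-1}.
XS : (ℕ → ℕ) → ℕ → ℕ³
XS a 0 = (0 , 0 , 1)
XS a 1 = (1 , 0 , 0)
XS a 2 = (1 , 1 , 0)
XS a (suc (suc (suc k))) = (XS a k ⊕ (a k ⊙ XS a (suc k))) ⊕ XS a (suc (suc k))

ℚ² : Set
ℚ² = ℚ × ℚ

-- V̂ = (b/a, c/a); the case a = 0 (never used: all first components
-- involved below are ≥ 1) is given the junk value (0,0).
hat : ℕ³ → ℚ²
hat (zero , b , c) = (0ℚ , 0ℚ)
hat (suc m , b , c) = ((+ b) / suc m , (+ c) / suc m)

_+̂_ : ℕ³ → ℕ³ → ℚ²
V +̂ W = hat (V ⊕ W)

-- endpoints of the segment for n ≥ 0: X̂_{n-1} and X_n +̂ X_{n-2}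
segStart : (ℕ → ℕ) → ℕ → ℚ²
segStart a n = hat (XS a (suc (suc n)))

segEnd : (ℕ → ℕ) → ℕ → ℚ²
segEnd a n = XS a (suc (suc (suc n))) +̂ XS a (suc n)

segPoint : ℚ² → ℚ² → ℚ → ℚ²
segPoint (p₁ , p₂) (q₁ , q₂) t = (p₁ + t * (q₁ - p₁) , p₂ + t * (q₂ - p₂))

{-# OPTIONS --safe #-}
module Submission where

-- Write A, B, C for three consecutive vectors X_{j-3}, X_{j-2}, X_{j-1}. The hats of the
-- integer vectors c₁ B + c₂ C + c₃ (C + A) with c₁, c₂, c₃ > 0 fill the interior of the current
-- partition triangle (for the initial triple it is Δ, with vertices (0,0), (1,0), (1,1)).
-- Dividing c₁ = k c₃ + m, the next digit a_j = k replaces (A, B, C) by (B, C, A + k B + C) and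
-- the coordinates by (c₂, c₃ - m, m). This is Euclid's algorithm on c₃; when it stops (m = 0)
-- the vector is a positive combination of X_{n-1} and X_n + X_{n-2}, so its hat lies on the
-- segment. Hence every rational point (p, q)/(r+1) with 0 < q < p ≤ r lies on a segment, and
-- such points approximate every point of Δ.

open import Defs
open import Data.Nat as ℕ using (ℕ; zero; suc; _+_; _*_; _∸_; z≤n; s≤s)
open import Data.Nat.DivMod using (_divMod_; result)
open import Data.Nat.Induction using (<-wellFounded)
import Data.Nat.Properties as ℕ
import Data.Nat.Tactic.RingSolver as ℕ-Solver
open import Data.Nat.Coprimality using (Coprime)
open import Data.Fin using (toℕ; zero; suc)
open import Data.Fin.Properties using (toℕ<n)
open import Data.Integer as ℤ using (ℤ; +_; +0; +[1+_]; -[1+_])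
open import Data.Integer.Properties using (pos-+; pos-*; neg-distribˡ-*; ∣-i∣≡∣i∣; drop‿+≤+)
import Data.Integer.Properties as ℤ
import Data.Integer.Tactic.RingSolver as ℤ-Solver
open import Data.List using (_∷_; [])
open import Data.Rational as ℚ using (ℚ; mkℚ; _/_; _-_; ∣_∣; _<_; _≤_; 0ℚ; 1ℚ; toℚᵘ; fromℚᵘ)
open import Data.Rational.Properties
  using (toℚᵘ-injective; toℚᵘ-fromℚᵘ; fromℚᵘ-cong; toℚᵘ-homo-+; toℚᵘ-homo-*; toℚᵘ-homo‿-;
         toℚᵘ-homo-∣-∣; toℚᵘ-cancel-<; toℚᵘ-cancel-≤; drop-*≤*; <-≤-trans; ≤-trans)
open import Data.Rational.Unnormalised as ℚᵘ using (ℚᵘ; mkℚᵘ; *≡*; *<*; *≤*) renaming (_≃_ to _≃ᵘ_)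
import Data.Rational.Unnormalised.Properties as ℚᵘ
open import Data.Product using (_×_; _,_; Σ; proj₁; proj₂)
open import Function using (const; _∘_)
open import Induction.WellFounded using (Acc; acc)
open import Relation.Binary.PropositionalEquality
open import Relation.Nullary using (contradiction)

Triple : Set
Triple = ℕ³ × ℕ³ × ℕ³

XS-from : Triple → (ℕ → ℕ) → ℕ → ℕ³
XS-from (A , B , C) a 0 = A
XS-from (A , B , C) a 1 = B
XS-from (A , B , C) a 2 = C
XS-from s a (suc (suc (suc k))) =
  (XS-from s a k ⊕ (a k ⊙ XS-from s a (suc k))) ⊕ XS-from s a (suc (suc k))

initial : Triple
initial = ((0 , 0 , 1) , (1 , 0 , 0) , (1 , 1 , 0))

step : ℕ → Triple → Triple
step k (A , B , C) = (B , C , (A ⊕ (k ⊙ B)) ⊕ C)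

_∷ˢ_ : ℕ → (ℕ → ℕ) → ℕ → ℕ
(k ∷ˢ a) zero = k
(k ∷ˢ a) (suc i) = a i

SatisfiesRecurrence : (ℕ → ℕ) → (ℕ → ℕ³) → Set
SatisfiesRecurrence a f = ∀ k → f (3 + k) ≡ (f k ⊕ (a k ⊙ f (1 + k))) ⊕ f (2 + k)

module _ (a : ℕ → ℕ) {f g : ℕ → ℕ³} (rf : SatisfiesRecurrence a f) (rg : SatisfiesRecurrence a g)
         (e₀ : f 0 ≡ g 0) (e₁ : f 1 ≡ g 1) (e₂ : f 2 ≡ g 2) where

  recurrence-unique : f ≗ g
  recurrence-unique 0 = e₀
  recurrence-unique 1 = e₁
  recurrence-unique 2 = e₂
  recurrence-unique (suc (suc (suc k))) = begin
    f (3 + k)                                ≡⟨ rf k ⟩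
    (f k ⊕ (a k ⊙ f (1 + k))) ⊕ f (2 + k)    ≡⟨ cong₂ _⊕_ (cong₂ (λ u v → u ⊕ (a k ⊙ v))
                                                               (recurrence-unique k)
                                                               (recurrence-unique (suc k)))
                                                   (recurrence-unique (suc (suc k))) ⟩
    (g k ⊕ (a k ⊙ g (1 + k))) ⊕ g (2 + k)    ≡⟨ rg k ⟨
    g (3 + k)                                ∎
    where open ≡-Reasoning

XS≗XS-from-initial : ∀ a → XS a ≗ XS-from initial a
XS≗XS-from-initial a = recurrence-unique a (λ _ → refl) (λ _ → refl) refl refl refl

XS-from-∷ˢ : ∀ s k a → XS-from s (k ∷ˢ a) ∘ suc ≗ XS-from (step k s) a
XS-from-∷ˢ (A , B , C) k a = recurrence-unique a (λ _ → refl) (λ _ → refl) refl refl refl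

XS-first-positive : ∀ a j → 0 ℕ.< proj₁ (XS a (suc j))
XS-first-positive a 0 = s≤s z≤n
XS-first-positive a 1 = s≤s z≤n
XS-first-positive a (suc (suc j)) = ℕ.≤-trans (XS-first-positive a (suc j)) (ℕ.m≤n+m _ _)

cone : ℕ → ℕ → ℕ → Triple → ℕ³
cone c₁ c₂ c₃ (A , B , C) = ((c₁ ⊙ B) ⊕ (c₂ ⊙ C)) ⊕ (c₃ ⊙ (C ⊕ A))

cone-initial : ∀ c₁ c₂ c₃ → cone c₁ c₂ c₃ initial ≡ (c₁ + (c₂ + c₃) , c₂ + c₃ , c₃)
cone-initial c₁ c₂ c₃ = cong₂ _,_ (first c₁ c₂ c₃) (cong₂ _,_ (second c₁ c₂ c₃) (third c₁ c₂ c₃))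
  where
  first : ∀ c₁ c₂ c₃ → (c₁ * 1 + c₂ * 1) + c₃ * 1 ≡ c₁ + (c₂ + c₃)
  first = ℕ-Solver.solve-∀
  second : ∀ c₁ c₂ c₃ → (c₁ * 0 + c₂ * 1) + c₃ * 1 ≡ c₂ + c₃
  second = ℕ-Solver.solve-∀
  third : ∀ c₁ c₂ c₃ → (c₁ * 0 + c₂ * 0) + c₃ * 1 ≡ c₃
  third = ℕ-Solver.solve-∀

SegmentCombination : ((ℕ → ℕ) → ℕ → ℕ³) → ℕ³ → Set
SegmentCombination X v = Σ ℕ λ n → Σ (ℕ → ℕ) λ a → Σ ℕ λ α → Σ ℕ λ β →
  v ≡ (α ⊙ X a (2 + n)) ⊕ (β ⊙ (X a (3 + n) ⊕ X a (1 + n)))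

SegmentCombination-cong : ∀ {X Y v} → (∀ a → X a ≗ Y a) → SegmentCombination X v → SegmentCombination Y v
SegmentCombination-cong X≗Y (n , a , α , β , refl) =
  n , a , α , β ,
  cong₂ (λ u w → (α ⊙ u) ⊕ (β ⊙ w)) (X≗Y a (2 + n)) (cong₂ _⊕_ (X≗Y a (3 + n)) (X≗Y a (1 + n)))

SegmentCombination-step : ∀ k s {v} →
  SegmentCombination (XS-from (step k s)) v → SegmentCombination (XS-from s) v
SegmentCombination-step k s (n , a , α , β , refl) =
  suc n , k ∷ˢ a , α , β ,
  sym (cong₂ (λ u w → (α ⊙ u) ⊕ (β ⊙ w))
             (XS-from-∷ˢ s k a (2 + n))
             (cong₂ _⊕_ (XS-from-∷ˢ s k a (3 + n)) (XS-from-∷ˢ s k a (1 + n))))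

cone-step : ∀ k {m d c₃} c₂ s → m + d ≡ c₃ → cone (m + k * c₃) c₂ c₃ s ≡ cone c₂ d m (step k s)
cone-step k {m} {d} c₂ ((A₁ , A₂ , A₃) , (B₁ , B₂ , B₃) , (C₁ , C₂ , C₃)) refl =
  cong₂ _,_ (identity k m d c₂ A₁ B₁ C₁) (cong₂ _,_ (identity k m d c₂ A₂ B₂ C₂) (identity k m d c₂ A₃ B₃ C₃))
  where
  identity : ∀ k m d c₂ a b c → ((m + k * (m + d)) * b + c₂ * c) + (m + d) * (c + a)
                             ≡ (c₂ * c + d * ((a + k * b) + c)) + m * (((a + k * b) + c) + b)
  identity = ℕ-Solver.solve-∀

cone-last : ∀ k c₂ c₃ s → SegmentCombination (XS-from s) (cone (suc k * c₃) c₂ c₃ s)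
cone-last k c₂ c₃ ((A₁ , A₂ , A₃) , (B₁ , B₂ , B₃) , (C₁ , C₂ , C₃)) =
  0 , const k , c₂ , c₃ ,
  cong₂ _,_ (identity k c₂ c₃ A₁ B₁ C₁) (cong₂ _,_ (identity k c₂ c₃ A₂ B₂ C₂) (identity k c₂ c₃ A₃ B₃ C₃))
  where
  identity : ∀ k c₂ c₃ a b c → (suc k * c₃ * b + c₂ * c) + c₃ * (c + a)
                             ≡ c₂ * c + c₃ * (((a + k * b) + c) + b)
  identity = ℕ-Solver.solve-∀

cone-segmentCombination : ∀ s c₁ c₂ c₃ → 0 ℕ.< c₁ → 0 ℕ.< c₂ → 0 ℕ.< c₃ →
  SegmentCombination (XS-from s) (cone c₁ c₂ c₃ s)
cone-segmentCombination s c₁ c₂ c₃ = euclid (<-wellFounded c₃) s c₁ c₂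
  where
  euclid : ∀ {c₃} → Acc ℕ._<_ c₃ → ∀ s c₁ c₂ → 0 ℕ.< c₁ → 0 ℕ.< c₂ → 0 ℕ.< c₃ →
    SegmentCombination (XS-from s) (cone c₁ c₂ c₃ s)
  euclid {suc c} (acc smaller) s c₁ c₂ 0<c₁ 0<c₂ _ with c₁ divMod suc c
  ... | result zero    zero refl = contradiction 0<c₁ λ ()
  ... | result (suc k) zero refl = cone-last k c₂ (suc c) s
  ... | result k (suc i) refl =
    SegmentCombination-step k s
      (subst (SegmentCombination (XS-from (step k s))) (sym (cone-step k {m} {d} c₂ s m+d≡c₃))
        (euclid (smaller m<c₃) (step k s) c₂ d 0<c₂ (ℕ.m<n⇒0<n∸m m<c₃) (s≤s z≤n)))
    where
    m = toℕ (suc i)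
    d = suc c ∸ m
    m<c₃ = toℕ<n (suc i)
    m+d≡c₃ = ℕ.m+[n∸m]≡n (ℕ.<⇒≤ m<c₃)

interior-point-segmentCombination : ∀ r p q → 0 ℕ.< q → q ℕ.< p → p ℕ.≤ r →
  SegmentCombination XS (suc r , p , q)
interior-point-segmentCombination r p q 0<q q<p p≤r =
  SegmentCombination-cong (λ a j → sym (XS≗XS-from-initial a j))
    (subst (SegmentCombination (XS-from initial)) cone≡
      (cone-segmentCombination initial c₁ c₂ q (ℕ.m<n⇒0<n∸m (s≤s p≤r)) (ℕ.m<n⇒0<n∸m q<p) 0<q))
  where
  c₁ = suc r ∸ p
  c₂ = p ∸ q
  c₂+q≡p : c₂ + q ≡ p
  c₂+q≡p = ℕ.m∸n+n≡m (ℕ.<⇒≤ q<p)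
  c₁+p≡1+r : c₁ + p ≡ suc r
  c₁+p≡1+r = ℕ.m∸n+n≡m (ℕ.≤-trans p≤r (ℕ.n≤1+n r))
  cone≡ : cone c₁ c₂ q initial ≡ (suc r , p , q)
  cone≡ = trans (cone-initial c₁ c₂ q)
    (cong₂ _,_ (trans (cong (λ n → c₁ + n) c₂+q≡p) c₁+p≡1+r) (cong₂ _,_ c₂+q≡p refl))

pos-linear : ∀ α u β v → + (α * u + β * v) ≡ + α ℤ.* + u ℤ.+ + β ℤ.* + v
pos-linear α u β v = trans (pos-+ (α * u) (β * v)) (cong₂ ℤ._+_ (pos-* α u) (pos-* β v))

toℚᵘ-homo-− : ∀ p q → toℚᵘ (p - q) ≃ᵘ toℚᵘ p ℚᵘ.- toℚᵘ q
toℚᵘ-homo-− p q = ℚᵘ.≃-trans (toℚᵘ-homo-+ p (ℚ.- q)) (ℚᵘ.+-congʳ (toℚᵘ p) (toℚᵘ-homo‿- q))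

fromℚᵘ-interpolate : ∀ p t q →
  fromℚᵘ p ℚ.+ fromℚᵘ t ℚ.* (fromℚᵘ q - fromℚᵘ p) ≡ fromℚᵘ (p ℚᵘ.+ t ℚᵘ.* (q ℚᵘ.- p))
fromℚᵘ-interpolate p t q = toℚᵘ-injective (begin
  toℚᵘ (P ℚ.+ T ℚ.* (Q - P))                      ≈⟨ toℚᵘ-homo-+ P _ ⟩
  toℚᵘ P ℚᵘ.+ toℚᵘ (T ℚ.* (Q - P))                ≈⟨ ℚᵘ.+-congʳ (toℚᵘ P) (toℚᵘ-homo-* T _) ⟩
  toℚᵘ P ℚᵘ.+ toℚᵘ T ℚᵘ.* toℚᵘ (Q - P)            ≈⟨ ℚᵘ.+-congʳ (toℚᵘ P) (ℚᵘ.*-congˡ {toℚᵘ T} (toℚᵘ-homo-− Q P)) ⟩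
  toℚᵘ P ℚᵘ.+ toℚᵘ T ℚᵘ.* (toℚᵘ Q ℚᵘ.- toℚᵘ P)    ≈⟨ ℚᵘ.+-cong p≃ (ℚᵘ.*-cong t≃ (ℚᵘ.+-cong q≃ (ℚᵘ.-‿cong p≃))) ⟩
  p ℚᵘ.+ t ℚᵘ.* (q ℚᵘ.- p)                        ≈⟨ toℚᵘ-fromℚᵘ _ ⟨
  toℚᵘ (fromℚᵘ (p ℚᵘ.+ t ℚᵘ.* (q ℚᵘ.- p)))        ∎)
  where
  open ℚᵘ.≃-Reasoning
  P = fromℚᵘ p; T = fromℚᵘ t; Q = fromℚᵘ q
  p≃ = toℚᵘ-fromℚᵘ p; t≃ = toℚᵘ-fromℚᵘ t; q≃ = toℚᵘ-fromℚᵘ q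

interpolateᵘ-mediant : ∀ (U V α β : ℤ) a b r → + suc r ≡ α ℤ.* + suc a ℤ.+ β ℤ.* + suc b →
  mkℚᵘ U a ℚᵘ.+ mkℚᵘ (β ℤ.* + suc b) r ℚᵘ.* (mkℚᵘ V b ℚᵘ.- mkℚᵘ U a) ≃ᵘ mkℚᵘ (α ℤ.* U ℤ.+ β ℤ.* V) r
interpolateᵘ-mediant U V α β a b r = *≡* ∘ cross-multiplied U V (+ suc a) (+ suc b) (+ suc r) α β
  where
  cross-multiplied : ∀ U V A B R α β → R ≡ α ℤ.* A ℤ.+ β ℤ.* B →
    (U ℤ.* (R ℤ.* (B ℤ.* A)) ℤ.+ β ℤ.* B ℤ.* (V ℤ.* A ℤ.+ ℤ.- U ℤ.* B) ℤ.* A) ℤ.* R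
      ≡ (α ℤ.* U ℤ.+ β ℤ.* V) ℤ.* (A ℤ.* (R ℤ.* (B ℤ.* A)))
  cross-multiplied U V A B _ α β refl = ℤ-Solver.solve (U ∷ V ∷ A ∷ B ∷ α ∷ β ∷ [])

interpolate-mediant : ∀ α β u v a b r → suc r ≡ α * suc a + β * suc b →
  (+ u) / suc a ℚ.+ ((+ (β * suc b)) / suc r) ℚ.* ((+ v) / suc b - (+ u) / suc a)
    ≡ (+ (α * u + β * v)) / suc r
interpolate-mediant α β u v a b r eq = begin
  fromℚᵘ P ℚ.+ fromℚᵘ (T (+ (β * suc b))) ℚ.* (fromℚᵘ Q - fromℚᵘ P)
    ≡⟨ fromℚᵘ-interpolate P (T (+ (β * suc b))) Q ⟩
  fromℚᵘ (P ℚᵘ.+ T (+ (β * suc b)) ℚᵘ.* (Q ℚᵘ.- P))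
    ≡⟨ cong (λ n → fromℚᵘ (P ℚᵘ.+ T n ℚᵘ.* (Q ℚᵘ.- P))) (pos-* β (suc b)) ⟩
  fromℚᵘ (P ℚᵘ.+ T (+ β ℤ.* + suc b) ℚᵘ.* (Q ℚᵘ.- P))
    ≡⟨ fromℚᵘ-cong (interpolateᵘ-mediant (+ u) (+ v) (+ α) (+ β) a b r
                      (trans (cong +_ eq) (pos-linear α (suc a) β (suc b)))) ⟩
  fromℚᵘ (mkℚᵘ (+ α ℤ.* + u ℤ.+ + β ℤ.* + v) r)
    ≡⟨ cong (λ n → fromℚᵘ (mkℚᵘ n r)) (pos-linear α u β v) ⟨
  (+ (α * u + β * v)) / suc r ∎
  where
  open ≡-Reasoning
  P = mkℚᵘ (+ u) a; Q = mkℚᵘ (+ v) b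
  T : ℤ → ℚᵘ
  T n = mkℚᵘ n r

segPoint-hat-combination : ∀ α β V W r → proj₁ ((α ⊙ V) ⊕ (β ⊙ W)) ≡ suc r →
  0 ℕ.< proj₁ V → 0 ℕ.< proj₁ W →
  segPoint (hat V) (hat W) ((+ (β * proj₁ W)) / suc r) ≡ hat ((α ⊙ V) ⊕ (β ⊙ W))
segPoint-hat-combination α β (suc a , V₁ , V₂) (suc b , W₁ , W₂) r eq _ _ rewrite eq =
  cong₂ _,_ (interpolate-mediant α β V₁ W₁ a b r (sym eq)) (interpolate-mediant α β V₂ W₂ a b r (sym eq))

fraction-in-unit-interval : ∀ n r → n ℕ.≤ suc r → 0ℚ ≤ (+ n) / suc r × (+ n) / suc r ≤ 1ℚ
fraction-in-unit-interval n r n≤1+r =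
  toℚᵘ-cancel-≤ (ℚᵘ.≤-respʳ-≃ (ℚᵘ.≃-sym n/1+r≃)
    (*≤* (subst (+0 ℤ.≤_) (sym (ℤ.*-identityʳ (+ n))) (ℤ.+≤+ z≤n)))) ,
  toℚᵘ-cancel-≤ (ℚᵘ.≤-respˡ-≃ (ℚᵘ.≃-sym n/1+r≃)
    (*≤* (subst₂ ℤ._≤_ (sym (ℤ.*-identityʳ (+ n))) (sym (ℤ.*-identityˡ (+ suc r))) (ℤ.+≤+ n≤1+r))))
  where
  n/1+r≃ = toℚᵘ-fromℚᵘ (mkℚᵘ (+ n) r)

LiesOnSegment : ℚ² → Set
LiesOnSegment P = Σ ℕ λ n → Σ (ℕ → ℕ) λ a → Σ ℚ λ t →
  0ℚ ≤ t × t ≤ 1ℚ × segPoint (segStart a n) (segEnd a n) t ≡ P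

interior-point-on-segment : ∀ r p q → 0 ℕ.< q → q ℕ.< p → p ℕ.≤ r →
  LiesOnSegment ((+ p) / suc r , (+ q) / suc r)
interior-point-on-segment r p q 0<q q<p p≤r with interior-point-segmentCombination r p q 0<q q<p p≤r
... | n , a , α , β , eq = n , a , t , proj₁ t∈[0,1] , proj₂ t∈[0,1] , on-segment
  where
  V = XS a (2 + n)
  W = XS a (3 + n) ⊕ XS a (1 + n)
  t = (+ (β * proj₁ W)) / suc r
  1+r≡αV+βW : suc r ≡ α * proj₁ V + β * proj₁ W
  1+r≡αV+βW = cong proj₁ eq
  t∈[0,1] = fraction-in-unit-interval (β * proj₁ W) r
              (subst (β * proj₁ W ℕ.≤_) (sym 1+r≡αV+βW) (ℕ.m≤n+m _ _))
  on-segment : segPoint (hat V) (hat W) t ≡ ((+ p) / suc r , (+ q) / suc r)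
  on-segment = trans (segPoint-hat-combination α β V W r (sym 1+r≡αV+βW)
                        (XS-first-positive a (suc n)) (ℕ.≤-trans (XS-first-positive a (2 + n)) (ℕ.m≤m+n _ _)))
                     (cong hat (sym eq))

fraction-distance< : ∀ {X dx E de} .{cx : Coprime X (suc dx)} .{cε : Coprime (suc E) (suc de)} p r d →
  X * suc r ≡ p * suc dx + d → d * suc de ℕ.≤ suc dx * r →
  ∣ (+ p) / suc r - mkℚ (+ X) dx cx ∣ < mkℚ +[1+ E ] de cε
fraction-distance< {X} {dx} {E} {de} {cx} p r d split d≤ =
  toℚᵘ-cancel-< (ℚᵘ.<-respˡ-≃ (ℚᵘ.≃-sym distance)
    (*<* (subst₂ ℤ._<_ (pos-* d (suc de)) (pos-* (suc E) _) (ℤ.+<+ bound))))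
  where
  numerator : ℤ.∣ + p ℤ.* + suc dx ℤ.+ ℤ.- (+ X) ℤ.* + suc r ∣ ≡ d
  numerator = begin
    ℤ.∣ P ℤ.+ ℤ.- (+ X) ℤ.* + suc r ∣       ≡⟨ cong (λ n → ℤ.∣ P ℤ.+ n ∣) (neg-distribˡ-* (+ X) (+ suc r)) ⟨
    ℤ.∣ P ℤ.+ ℤ.- (+ X ℤ.* + suc r) ∣       ≡⟨ cong (λ n → ℤ.∣ P ℤ.+ ℤ.- n ∣) split′ ⟩
    ℤ.∣ P ℤ.+ ℤ.- (P ℤ.+ + d) ∣             ≡⟨ cong ℤ.∣_∣ (cancel P (+ d)) ⟩
    ℤ.∣ ℤ.- + d ∣                           ≡⟨ ∣-i∣≡∣i∣ (+ d) ⟩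
    d                                       ∎
    where
    open ≡-Reasoning
    P = + p ℤ.* + suc dx
    cancel : ∀ P D → P ℤ.+ ℤ.- (P ℤ.+ D) ≡ ℤ.- D
    cancel = ℤ-Solver.solve-∀
    split′ : + X ℤ.* + suc r ≡ P ℤ.+ + d
    split′ = begin
      + X ℤ.* + suc r          ≡⟨ pos-* X (suc r) ⟨
      + (X * suc r)            ≡⟨ cong +_ split ⟩
      + (p * suc dx + d)       ≡⟨ pos-+ (p * suc dx) d ⟩
      + (p * suc dx) ℤ.+ + d   ≡⟨ cong (λ n → n ℤ.+ + d) (pos-* p (suc dx)) ⟩
      P ℤ.+ + d                ∎
  distance : toℚᵘ ∣ (+ p) / suc r - mkℚ (+ X) dx cx ∣ ≃ᵘ mkℚᵘ (+ d) (ℕ.pred (suc r * suc dx))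
  distance = begin
    toℚᵘ ∣ (+ p) / suc r - mkℚ (+ X) dx cx ∣          ≈⟨ toℚᵘ-homo-∣-∣ _ ⟩
    ℚᵘ.∣ toℚᵘ ((+ p) / suc r - mkℚ (+ X) dx cx) ∣    ≈⟨ ℚᵘ.∣-∣-cong (toℚᵘ-homo-− ((+ p) / suc r) (mkℚ (+ X) dx cx)) ⟩
    ℚᵘ.∣ toℚᵘ ((+ p) / suc r) ℚᵘ.- mkℚᵘ (+ X) dx ∣   ≈⟨ ℚᵘ.∣-∣-cong (ℚᵘ.+-congˡ (ℚᵘ.- mkℚᵘ (+ X) dx)
                                                                                (toℚᵘ-fromℚᵘ (mkℚᵘ (+ p) r))) ⟩
    ℚᵘ.∣ mkℚᵘ (+ p) r ℚᵘ.- mkℚᵘ (+ X) dx ∣           ≡⟨ cong (λ n → mkℚᵘ (+ n) _) numerator ⟩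
    mkℚᵘ (+ d) (ℕ.pred (suc r * suc dx))             ∎
    where open ℚᵘ.≃-Reasoning
  bound : d * suc de ℕ.< suc E * (suc r * suc dx)
  bound = begin-strict
    d * suc de                 ≤⟨ d≤ ⟩
    suc dx * r                 <⟨ ℕ.*-monoʳ-< (suc dx) (ℕ.n<1+n r) ⟩
    suc dx * suc r             ≡⟨ ℕ.*-comm (suc dx) (suc r) ⟩
    suc r * suc dx             ≤⟨ ℕ.m≤n*m (suc r * suc dx) (suc E) ⟩
    suc E * (suc r * suc dx)   ∎
    where open ℕ.≤-Reasoning

numerators-≤ : ∀ {m n d e} .{c : Coprime m (suc d)} .{c′ : Coprime n (suc e)} →
  mkℚ (+ m) d c ≤ mkℚ (+ n) e c′ → m * suc e ℕ.≤ n * suc d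
numerators-≤ {m} {n} {d} {e} h =
  drop‿+≤+ (subst₂ ℤ._≤_ (sym (pos-* m (suc e))) (sym (pos-* n (suc d))) (drop-*≤* h))

numerator-≤-denominator : ∀ {m d} .{c : Coprime m (suc d)} → mkℚ (+ m) d c ≤ 1ℚ → m ℕ.≤ suc d
numerator-≤-denominator {m} {d} h = subst₂ ℕ._≤_ (ℕ.*-identityʳ m) (ℕ.*-identityˡ (suc d)) (numerators-≤ h)

-- The target is (X / Dx, Y⁺ / Dy) and the tolerance 1 / De. The chosen point (p, q) / (r + 1)
-- lies below and to the left of it, at distance X / (Dx (r + 1)) and (Dy + Y⁺) / (Dy (r + 1));
-- the factor M = 2 De makes both less than 1 / De.
module Approximant (X dx Y dy de : ℕ) where

  open ℕ.≤-Reasoning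

  Dx = suc dx; Dy = suc dy; De = suc de; Y⁺ = suc Y
  M = De + De

  r p q : ℕ
  r = M * Dx * Dy
  p = M * X * Dy
  q = ℕ.pred (M * Y⁺ * Dx)

  M≤r : M ℕ.≤ r
  M≤r = ℕ.≤-trans (ℕ.m≤m*n M Dx) (ℕ.m≤m*n (M * Dx) Dy)

  p≤r : X ℕ.≤ Dx → p ℕ.≤ r
  p≤r X≤Dx = ℕ.*-monoˡ-≤ Dy (ℕ.*-monoʳ-≤ M X≤Dx)

  q<p : Y⁺ * Dx ℕ.≤ X * Dy → q ℕ.< p
  q<p Y⁺Dx≤XDy = begin
    suc q          ≡⟨ ℕ.*-assoc M Y⁺ Dx ⟩
    M * (Y⁺ * Dx)  ≤⟨ ℕ.*-monoʳ-≤ M Y⁺Dx≤XDy ⟩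
    M * (X * Dy)   ≡⟨ ℕ.*-assoc M X Dy ⟨
    p              ∎

  0<q : 0 ℕ.< q
  0<q = ℕ.pred-mono-≤ (begin
    2              ≤⟨ ℕ.+-mono-≤ (s≤s z≤n) (s≤s z≤n) ⟩
    M              ≤⟨ ℕ.≤-trans (ℕ.m≤m*n M Y⁺) (ℕ.m≤m*n (M * Y⁺) Dx) ⟩
    M * Y⁺ * Dx    ∎)

  x-split : X * suc r ≡ p * Dx + X
  x-split = identity X M Dx Dy
    where
    identity : ∀ X M Dx Dy → X * suc (M * Dx * Dy) ≡ M * X * Dy * Dx + X
    identity = ℕ-Solver.solve-∀

  y-split : Y⁺ * suc r ≡ q * Dy + (Dy + Y⁺)
  y-split = trans (expand Y⁺ M Dx Dy) (regroup q Dy Y⁺)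
    where
    expand : ∀ Y M Dx Dy → Y * suc (M * Dx * Dy) ≡ M * Y * Dx * Dy + Y
    expand = ℕ-Solver.solve-∀
    regroup : ∀ q D Y → suc q * D + Y ≡ q * D + (D + Y)
    regroup = ℕ-Solver.solve-∀

  x-error≤ : X ℕ.≤ Dx → X * De ℕ.≤ Dx * r
  x-error≤ X≤Dx = begin
    X * De     ≤⟨ ℕ.*-monoˡ-≤ De X≤Dx ⟩
    Dx * De    ≤⟨ ℕ.*-monoʳ-≤ Dx (ℕ.≤-trans (ℕ.m≤m+n De De) M≤r) ⟩
    Dx * r     ∎

  y-error≤ : Y⁺ ℕ.≤ Dy → (Dy + Y⁺) * De ℕ.≤ Dy * r
  y-error≤ Y⁺≤Dy = begin
    (Dy + Y⁺) * De   ≤⟨ ℕ.*-monoˡ-≤ De (ℕ.+-monoʳ-≤ Dy Y⁺≤Dy) ⟩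
    (Dy + Dy) * De   ≡⟨ trans (ℕ.*-distribʳ-+ De Dy Dy) (sym (ℕ.*-distribˡ-+ Dy De De)) ⟩
    Dy * M           ≤⟨ ℕ.*-monoʳ-≤ Dy M≤r ⟩
    Dy * r           ∎

interior-point-approximation : ∀ x y ε → y ≤ x → x ≤ 1ℚ → 0ℚ < y → 0ℚ < ε →
  Σ ℕ λ r → Σ ℕ λ p → Σ ℕ λ q → 0 ℕ.< q × q ℕ.< p × p ℕ.≤ r ×
    ∣ (+ p) / suc r - x ∣ < ε × ∣ (+ q) / suc r - y ∣ < ε
interior-point-approximation (mkℚ -[1+ _ ] _ _) _ _ y≤x _ 0<y _ with <-≤-trans 0<y y≤x
... | ℚ.*<* ()
interior-point-approximation _ (mkℚ +0 _ _)       _ _ _ (ℚ.*<* (ℤ.+<+ ())) _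
interior-point-approximation _ (mkℚ -[1+ _ ] _ _) _ _ _ (ℚ.*<* ()) _
interior-point-approximation _ _ (mkℚ +0 _ _)       _ _ _ (ℚ.*<* (ℤ.+<+ ()))
interior-point-approximation _ _ (mkℚ -[1+ _ ] _ _) _ _ _ (ℚ.*<* ())
interior-point-approximation (mkℚ (+ X) dx _) (mkℚ +[1+ Y ] dy _) (mkℚ +[1+ E ] de _) y≤x x≤1 _ _ =
  r , p , q , 0<q , q<p (numerators-≤ y≤x) , p≤r X≤Dx ,
  fraction-distance< p r X x-split (x-error≤ X≤Dx) ,
  fraction-distance< q r (Dy + Y⁺) y-split (y-error≤ (numerator-≤-denominator (≤-trans y≤x x≤1)))
  where
  open Approximant X dx Y dy de
  X≤Dx = numerator-≤-denominator x≤1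

close-to-segment : ∀ {x y ε P} → LiesOnSegment P → ∣ proj₁ P - x ∣ < ε → ∣ proj₂ P - y ∣ < ε →
  Σ ℕ λ n → Σ (ℕ → ℕ) λ a → Σ ℚ λ t →
    (0ℚ ≤ t) × (t ≤ 1ℚ) ×
    (∣ proj₁ (segPoint (segStart a n) (segEnd a n) t) - x ∣ < ε) ×
    (∣ proj₂ (segPoint (segStart a n) (segEnd a n) t) - y ∣ < ε)
close-to-segment (n , a , t , 0≤t , t≤1 , refl) close-x close-y = n , a , t , 0≤t , t≤1 , close-x , close-y

lemma18 : (x y : ℚ) → y ≤ x → x ≤ 1ℚ → 0ℚ < y →
    (ε : ℚ) → 0ℚ < ε →
    Σ ℕ λ n → Σ (ℕ → ℕ) λ a → Σ ℚ λ t →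
      (0ℚ ≤ t) × (t ≤ 1ℚ) ×
      (∣ proj₁ (segPoint (segStart a n) (segEnd a n) t) - x ∣ < ε) ×
      (∣ proj₂ (segPoint (segStart a n) (segEnd a n) t) - y ∣ < ε)
lemma18 x y y≤x x≤1 0<y ε 0<ε =
  let r , p , q , 0<q , q<p , p≤r , close-x , close-y = interior-point-approximation x y ε y≤x x≤1 0<y 0<ε
  in close-to-segment (interior-point-on-segment r p q 0<q q<p p≤r) close-x close-y
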